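{- Let $W\subset\mathbb{A}^5$ be the variety with coordinates $(b,x,y,u,v)$ defined by $x^3+y^3=u+bv$ and $u^3+v^3=x+by$. Then $W$ contains the two rational curves parametrized by $$b(t)=9t^2+15t+7,\ x(t)=2t+2,\ y(t)=t,\ u(t)=2t+1,\ v(t)=t+1,$$ and $$b(t)=9t^2+21t+13,\ x(t)=2t+3,\ y(t)=t+1,\ u(t)=2t+2,\ v(t)=t+2.$$ For each of these curves and every integer $\mathbf{t}\ge0$, setting $n(\mathbf{t})=x(\mathbf{t})+y(\mathbf{t})b(\mathbf{t})$ and $m(\mathbf{t})=u(\mathbf{t})+v(\mathbf{t})b(\mathbf{t})$, the pair $\mathrm{cyc}(n(\mathbf{t}),m(\mathbf{t}))$ is a $2$-cycle of $S_{x^3,b(\mathbf{t})}$.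
   Context: For an integer $b\ge2$, $S_{x^3,b}(n)=x_0^3+\dots+x_d^3$ where $n=x_0+x_1b+\dots+x_db^d$ is the base-$b$ expansion of $n\ge0$ ($0\le x_i<b$). A $2$-cycle $\mathrm{cyc}(n,m)$ of $S_{x^3,b}$ consists of two distinct positive integers with $S_{x^3,b}(n)=m$ and $S_{x^3,b}(m)=n$. -}

module Defs where

open import Data.Nat using (ℕ; zero; suc; _+_; _*_; _^_; _<_)
open import Data.Nat.DivMod using (_/_; _%_)
open import Data.Product using (_×_)
open import Relation.Binary.PropositionalEquality using (_≡_; _≢_)

-- Once the number reaches 0 further
-- iterations contribute 0^3 = 0, so any fuel ≥ number of digits is exact.
sumCubesFuel : ℕ → (b : ℕ) → ℕ → ℕ
sumCubesFuel zero    b       n = 0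
sumCubesFuel (suc k) zero    n = 0   -- base 0 is meaningless; never used
sumCubesFuel (suc k) (suc c) n =
  (n % suc c) ^ 3 + sumCubesFuel k (suc c) (n / suc c)

-- S_{x^3,b}(n) = x_0^3 + ... + x_d^3 for the base-b expansion of n
-- (meaningful for b ≥ 2; n has at most n digits, so fuel n suffices,
-- and n = 0 gives 0).
S : (b : ℕ) → ℕ → ℕ
S b n = sumCubesFuel n b n

IsTwoCycle : (b n m : ℕ) → Set
IsTwoCycle b n m = (0 < n) × (0 < m) × (n ≢ m) × (S b n ≡ m) × (S b m ≡ n)

{-# OPTIONS --safe #-}
-- For t ≥ 0 all four of x, y, u, v lie below the quadratic b, so x + y b and
-- u + v b are two-digit base-b numerals with digit-cube sums u + v b and x + y b
-- respectively; they differ because (u + v b) − (x + y b) = b − 1 > 0.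
module Submission where

open import Defs
open import Data.Nat using (ℕ; zero; suc; _+_; _*_; _^_; _≤_; _<_; z<s; NonZero)
open import Data.Integer using (ℤ)
open import Data.Product using (_×_; _,_)
open import Relation.Binary.PropositionalEquality
  using (_≡_; refl; sym; trans; cong; cong₂; subst; module ≡-Reasoning)
import Data.Nat as N
import Data.Integer as Z
open import Data.Nat.Properties
open import Data.Nat.DivMod
open import Data.Nat.Divisibility using (n∣m*n)
open import Data.List using (_∷_; [])
open import Function.Base using (_∋_)
import Data.Nat.Tactic.RingSolver as ℕ-Solver
import Data.Integer.Tactic.RingSolver as ℤ-Solver

-- Phrased with `+ 1` instead of `suc`, which the ring solver cannot see through.
<-offset : ∀ {m k n} → m + k + 1 ≡ n → m < n
<-offset {m} {k} refl = ≤-<-trans (m≤m+n m k) (m<m+n (m + k) z<s)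

[m+kn]/n≡k : ∀ {m n} k .{{_ : NonZero n}} → m < n → (m + k * n) / n ≡ k
[m+kn]/n≡k {m} {n} k m<n = begin
  (m + k * n) / n    ≡⟨ +-distrib-/-∣ʳ m (n∣m*n k) ⟩
  m / n + k * n / n  ≡⟨ cong₂ _+_ (m<n⇒m/n≡0 m<n) (m*n/n≡m k n) ⟩
  k                  ∎
  where open ≡-Reasoning

[m+kn]%n≡m : ∀ {m n} k .{{_ : NonZero n}} → m < n → (m + k * n) % n ≡ m
[m+kn]%n≡m {m} {n} k m<n = trans ([m+kn]%n≡m%n m k n) (m<n⇒m%n≡m m<n)

sumCubesFuel-zero : ∀ k c → sumCubesFuel k (suc c) 0 ≡ 0
sumCubesFuel-zero zero    c = refl
sumCubesFuel-zero (suc k) c = sumCubesFuel-zero k c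

sumCubesFuel-digit : ∀ k {c y} → y < suc c → sumCubesFuel (suc k) (suc c) y ≡ y ^ 3
sumCubesFuel-digit k {c} {y} y<1+c = begin
  (y % suc c) ^ 3 + sumCubesFuel k (suc c) (y / suc c)
    ≡⟨ cong₂ (λ r q → r ^ 3 + sumCubesFuel k (suc c) q) (m<n⇒m%n≡m y<1+c) (m<n⇒m/n≡0 y<1+c) ⟩
  y ^ 3 + sumCubesFuel k (suc c) 0
    ≡⟨ cong (y ^ 3 +_) (sumCubesFuel-zero k c) ⟩
  y ^ 3 + 0
    ≡⟨ +-identityʳ (y ^ 3) ⟩
  y ^ 3 ∎
  where open ≡-Reasoning

sumCubesFuel-lowDigit : ∀ k {c x y} → x < suc c →
  sumCubesFuel (suc k) (suc c) (x + y * suc c) ≡ x ^ 3 + sumCubesFuel k (suc c) y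
sumCubesFuel-lowDigit k {c} {x} {y} x<1+c =
  cong₂ (λ r q → r ^ 3 + sumCubesFuel k (suc c) q)
    ([m+kn]%n≡m {x} y x<1+c) ([m+kn]/n≡k {x} y x<1+c)

-- S b n runs n rounds of digit extraction, so n ≥ 2 lets it read both digits.
S-twoDigits : ∀ {b x y} → x < b → y < b → 2 ≤ x + y * b → S b (x + y * b) ≡ x ^ 3 + y ^ 3
S-twoDigits {suc c} {x} {y} x<b y<b 2≤n
  with k , 2+k≡n ← m≤n⇒∃[o]m+o≡n 2≤n =
  subst (λ fuel → sumCubesFuel fuel (suc c) (x + y * suc c) ≡ x ^ 3 + y ^ 3) 2+k≡n
    (trans (sumCubesFuel-lowDigit (suc k) {y = y} x<b) (cong (x ^ 3 +_) (sumCubesFuel-digit k y<b)))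

m^3≡m*m*m : ∀ m → m ^ 3 ≡ m * m * m
m^3≡m*m*m m = trans (cong (λ z → m * (m * z)) (*-identityʳ m)) (sym (*-assoc m m m))

twoCycle-ofDigits : ∀ {b x y u v} → x < b → y < b → u < b → v < b →
  2 ≤ x + y * b → x + y * b < u + v * b →
  x * x * x + y * y * y ≡ u + v * b → u * u * u + v * v * v ≡ x + y * b →
  IsTwoCycle b (x + y * b) (u + v * b)
twoCycle-ofDigits {b} {x} {y} {u} {v} x<b y<b u<b v<b 2≤n n<m onW₁ onW₂ =
    <-≤-trans z<s 2≤n
  , <-≤-trans z<s 2≤m
  , <⇒≢ n<m
  , trans (S-twoDigits x<b y<b 2≤n) (trans (cong₂ _+_ (m^3≡m*m*m x) (m^3≡m*m*m y)) onW₁)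
  , trans (S-twoDigits u<b v<b 2≤m) (trans (cong₂ _+_ (m^3≡m*m*m u) (m^3≡m*m*m v)) onW₂)
  where
  2≤m : 2 ≤ u + v * b
  2≤m = ≤-trans 2≤n (<⇒≤ n<m)

curve₁-twoCycle : ∀ t →
  let b = 9 * t * t + 15 * t + 7; x = 2 * t + 2; y = t; u = 2 * t + 1; v = t + 1
  in IsTwoCycle b (x + y * b) (u + v * b)
-- The implicit arguments and the ascriptions keep the goals of the solver
-- macro free of metavariables.
curve₁-twoCycle t =
  let b = 9 * t * t + 15 * t + 7; x = 2 * t + 2; y = t; u = 2 * t + 1; v = t + 1
  in twoCycle-ofDigits {b} {x} {y} {u} {v}
    (<-offset (x + (9 * t * t + 13 * t + 4) + 1 ≡ b ∋ ℕ-Solver.solve (t ∷ [])))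
    (<-offset (y + (9 * t * t + 14 * t + 6) + 1 ≡ b ∋ ℕ-Solver.solve (t ∷ [])))
    (<-offset (u + (9 * t * t + 13 * t + 5) + 1 ≡ b ∋ ℕ-Solver.solve (t ∷ [])))
    (<-offset (v + (9 * t * t + 14 * t + 5) + 1 ≡ b ∋ ℕ-Solver.solve (t ∷ [])))
    (<-offset (1 + (2 * t + t * b) + 1 ≡ x + y * b ∋ ℕ-Solver.solve (t ∷ [])))
    (<-offset (x + y * b + (9 * t * t + 15 * t + 5) + 1 ≡ u + v * b ∋ ℕ-Solver.solve (t ∷ [])))
    (x * x * x + y * y * y ≡ u + v * b ∋ ℕ-Solver.solve (t ∷ []))
    (u * u * u + v * v * v ≡ x + y * b ∋ ℕ-Solver.solve (t ∷ []))

curve₂-twoCycle : ∀ t →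
  let b = 9 * t * t + 21 * t + 13; x = 2 * t + 3; y = t + 1; u = 2 * t + 2; v = t + 2
  in IsTwoCycle b (x + y * b) (u + v * b)
curve₂-twoCycle t =
  let b = 9 * t * t + 21 * t + 13; x = 2 * t + 3; y = t + 1; u = 2 * t + 2; v = t + 2
  in twoCycle-ofDigits {b} {x} {y} {u} {v}
    (<-offset (x + (9 * t * t + 19 * t + 9) + 1 ≡ b ∋ ℕ-Solver.solve (t ∷ [])))
    (<-offset (y + (9 * t * t + 20 * t + 11) + 1 ≡ b ∋ ℕ-Solver.solve (t ∷ [])))
    (<-offset (u + (9 * t * t + 19 * t + 10) + 1 ≡ b ∋ ℕ-Solver.solve (t ∷ [])))
    (<-offset (v + (9 * t * t + 20 * t + 10) + 1 ≡ b ∋ ℕ-Solver.solve (t ∷ [])))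
    (<-offset (1 + (2 * t + 1 + y * b) + 1 ≡ x + y * b ∋ ℕ-Solver.solve (t ∷ [])))
    (<-offset (x + y * b + (9 * t * t + 21 * t + 11) + 1 ≡ u + v * b ∋ ℕ-Solver.solve (t ∷ [])))
    (x * x * x + y * y * y ≡ u + v * b ∋ ℕ-Solver.solve (t ∷ []))
    (u * u * u + v * v * v ≡ x + y * b ∋ ℕ-Solver.solve (t ∷ []))

proposition5p7 :
  -- curve 1 lies on W : x^3 + y^3 = u + b v , u^3 + v^3 = x + b y
  ((t : ℤ) →
    let b = Z.+ 9 Z.* t Z.* t Z.+ Z.+ 15 Z.* t Z.+ Z.+ 7
        x = Z.+ 2 Z.* t Z.+ Z.+ 2
        y = t
        u = Z.+ 2 Z.* t Z.+ Z.+ 1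
        v = t Z.+ Z.+ 1
    in (x Z.* x Z.* x Z.+ y Z.* y Z.* y ≡ u Z.+ b Z.* v)
       × (u Z.* u Z.* u Z.+ v Z.* v Z.* v ≡ x Z.+ b Z.* y))
  -- curve 2 lies on W
  × ((t : ℤ) →
    let b = Z.+ 9 Z.* t Z.* t Z.+ Z.+ 21 Z.* t Z.+ Z.+ 13
        x = Z.+ 2 Z.* t Z.+ Z.+ 3
        y = t Z.+ Z.+ 1
        u = Z.+ 2 Z.* t Z.+ Z.+ 2
        v = t Z.+ Z.+ 2
    in (x Z.* x Z.* x Z.+ y Z.* y Z.* y ≡ u Z.+ b Z.* v)
       × (u Z.* u Z.* u Z.+ v Z.* v Z.* v ≡ x Z.+ b Z.* y))
  -- curve 1 gives 2-cycles for every integer t ≥ 0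
  × ((t : ℕ) →
    let b = 9 N.* t N.* t N.+ 15 N.* t N.+ 7
        x = 2 N.* t N.+ 2
        y = t
        u = 2 N.* t N.+ 1
        v = t N.+ 1
    in IsTwoCycle b (x N.+ y N.* b) (u N.+ v N.* b))
  -- curve 2 gives 2-cycles for every integer t ≥ 0
  × ((t : ℕ) →
    let b = 9 N.* t N.* t N.+ 21 N.* t N.+ 13
        x = 2 N.* t N.+ 3
        y = t N.+ 1
        u = 2 N.* t N.+ 2
        v = t N.+ 2
    in IsTwoCycle b (x N.+ y N.* b) (u N.+ v N.* b))
proposition5p7 =
    (λ t → ℤ-Solver.solve (t ∷ []) , ℤ-Solver.solve (t ∷ []))
  , (λ t → ℤ-Solver.solve (t ∷ []) , ℤ-Solver.solve (t ∷ []))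
  , curve₁-twoCycle
  , curve₂-twoCycle
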